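{- The category $\mathbf{Grphs}$ satisfies axioms (L1), (L3) and (L4), and does not satisfy axioms (L2), (L5) and (L6).
   Context: A (conceptual) graph $G$ consists of a set $P(G)$ of parts, a distinguished subset $V(G)\subseteq P(G)$ of vertices (given by an inclusion $\iota_G:V(G)\hookrightarrow P(G)$), and an incidence map $\partial_G:P(G)\to V(G)\underline{\times}V(G)$ into the set of unordered pairs of vertices (the pair of $u,v$ written $u\_v$; $u=v$ allowed), such that $\partial_G(v)=v\_v$ for every vertex $v$. The edges are $E(G)=P(G)\setminus V(G)$; an edge $e$ with $\partial_G(e)=u\_u$ is a loop. Vertex and edge sets may be infinite; multiple edges and multiple loops are allowed; the empty graph is allowed. A graph morphism $f:G\to H$ is a function $f:P(G)\to P(H)$ with $f(V(G))\subseteq V(H)$ such that $\partial_H(f(e))=f(x)\_f(y)$ whenever $\partial_G(e)=x\_y$ (edges may thus be mapped to vertices). $\mathbf{Grphs}$ is the category whose objects are all such graphs and whose morphisms are all graph morphisms, with composition of functions. The axioms, for a category $\mathcal{C}$: (L1) $\mathcal{C}$ has all finite limits and all finite colimits (terminal and initial objects, binary products and coproducts, equalizers and coequalizers). (L2) $\mathcal{C}$ has a terminal object, binary products, and exponentiation with evaluation: for all objects $A,B$ there are an object $B^A$ and a morphism $ev:B^A\times A\to B$ such that for every object $X$ and morphism $g:X\times A\to B$ there is a unique $\bar g:X\to B^A$ with $ev\circ(\bar g\times 1_A)=g$. (L3) $\mathcal{C}$ has a subobject classifier: a terminal object $\hat 1$, an object $\Omega$ and a morphism $\top:\hat1\to\Omega$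 such that for every monomorphism $m:S\to X$ there is a unique $\chi:X\to\Omega$ for which $m$ is a pullback of $\top$ along $\chi$. (L4) $\mathcal{C}$ has a natural number object: a terminal object $\hat1$, an object $N$ and morphisms $0:\hat1\to N$, $\sigma:N\to N$ such that for every object $X$ and morphisms $x:\hat1\to X$, $f:X\to X$ there is a unique $h:N\to X$ with $h0=x$ and $h\sigma=fh$. (L5) Choice: for every morphism $f:A\to B$ with $A$ not an initial object there is a morphism $g:B\to A$ with $fgf=f$. (L6) $\mathcal{C}$ has a subobject classifier $\top:\hat1\to\Omega$ and $\Omega$ is isomorphic to the coproduct $\hat1+\hat1$ (two-valued). -}

module Defs where

open import Level using (0ℓ)
open import Data.Product using (Σ; Σ-syntax; _×_; _,_; proj₁; proj₂)
open import Data.Sum using (_⊎_)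
open import Relation.Nullary using (¬_)
open import Relation.Binary using (Rel; IsEquivalence)

-- Unordered pairs: an ordered pair (a , b) represents the unordered pair
-- a_b; two representatives denote the same unordered pair iff they agree
-- up to swapping.

UEq : {A : Set} → Rel A 0ℓ → Rel (A × A) 0ℓ
UEq _≈_ (a , b) (c , d) = ((a ≈ c) × (b ≈ d)) ⊎ ((a ≈ d) × (b ≈ c))

-- Conceptual graphs.  Sets are modelled as setoids (carrier + equality),
-- so that quotients (needed for coequalizers) exist.

record Graph : Set₁ where
  field
    P        : Set
    _≈P_     : Rel P 0ℓ
    ≈P-equiv : IsEquivalence _≈P_
    V        : Set
    _≈V_     : Rel V 0ℓ
    ≈V-equiv : IsEquivalence _≈V_
    ι        : V → P
    ι-cong   : ∀ {u v} → u ≈V v → ι u ≈P ι v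
    ι-inj    : ∀ {u v} → ι u ≈P ι v → u ≈V v
    ∂        : P → V × V
    ∂-cong   : ∀ {p q} → p ≈P q → UEq _≈V_ (∂ p) (∂ q)
    ∂-vertex : ∀ v → UEq _≈V_ (∂ (ι v)) (v , v)

open Graph

record Hom (G H : Graph) : Set where
  field
    fun      : P G → P H
    cong     : ∀ {p q} → _≈P_ G p q → _≈P_ H (fun p) (fun q)
    vertex   : ∀ v → Σ[ w ∈ V H ] _≈P_ H (ι H w) (fun (ι G v))
    incident : ∀ e → UEq (_≈P_ H)
                         (ι H (proj₁ (∂ H (fun e))) , ι H (proj₂ (∂ H (fun e))))
                         (fun (ι G (proj₁ (∂ G e))) , fun (ι G (proj₂ (∂ G e))))

open Hom

_≈h_ : {G H : Graph} → Rel (Hom G H) 0ℓ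
_≈h_ {G} {H} f g = ∀ p → _≈P_ H (fun f p) (fun g p)

infix 4 _≈h_
infixr 9 _∘_

idH : (G : Graph) → Hom G G
idH G = record
  { fun = λ p → p
  ; cong = λ e → e
  ; vertex = λ v → v , IsEquivalence.refl (≈P-equiv G)
  ; incident = λ e → _⊎_.inj₁ (IsEquivalence.refl (≈P-equiv G) , IsEquivalence.refl (≈P-equiv G))
  }

_∘_ : {A B C : Graph} → Hom B C → Hom A B → Hom A C
_∘_ {A} {B} {C} g f = record
  { fun = λ p → fun g (fun f p)
  ; cong = λ e → cong g (cong f e)
  ; vertex = λ v → let (w , w≈) = vertex f v
                       (u , u≈) = vertex g w
                   in u , IsEquivalence.trans (≈P-equiv C) u≈ (cong g w≈)
  ; incident = λ e → inc e
  }
  where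
  open IsEquivalence (≈P-equiv C) renaming (refl to r; sym to s; trans to t)
  inc : ∀ e → UEq (_≈P_ C)
          (ι C (proj₁ (∂ C (fun g (fun f e)))) , ι C (proj₂ (∂ C (fun g (fun f e)))))
          (fun g (fun f (ι A (proj₁ (∂ A e)))) , fun g (fun f (ι A (proj₂ (∂ A e)))))
  inc e = helper (incident g (fun f e)) (incident f e)
    where
    helper : UEq (_≈P_ C)
               (ι C (proj₁ (∂ C (fun g (fun f e)))) , ι C (proj₂ (∂ C (fun g (fun f e)))))
               (fun g (ι B (proj₁ (∂ B (fun f e)))) , fun g (ι B (proj₂ (∂ B (fun f e)))))
           → UEq (_≈P_ B)
               (ι B (proj₁ (∂ B (fun f e))) , ι B (proj₂ (∂ B (fun f e))))
               (fun f (ι A (proj₁ (∂ A e))) , fun f (ι A (proj₂ (∂ A e))))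
           → UEq (_≈P_ C)
               (ι C (proj₁ (∂ C (fun g (fun f e)))) , ι C (proj₂ (∂ C (fun g (fun f e)))))
               (fun g (fun f (ι A (proj₁ (∂ A e)))) , fun g (fun f (ι A (proj₂ (∂ A e)))))
    helper (_⊎_.inj₁ (a , b)) (_⊎_.inj₁ (c , d)) = _⊎_.inj₁ (t a (cong g c) , t b (cong g d))
    helper (_⊎_.inj₁ (a , b)) (_⊎_.inj₂ (c , d)) = _⊎_.inj₂ (t a (cong g c) , t b (cong g d))
    helper (_⊎_.inj₂ (a , b)) (_⊎_.inj₁ (c , d)) = _⊎_.inj₂ (t a (cong g d) , t b (cong g c))
    helper (_⊎_.inj₂ (a , b)) (_⊎_.inj₂ (c , d)) = _⊎_.inj₁ (t a (cong g d) , t b (cong g c))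

IsTerminal : Graph → Set₁
IsTerminal T = ∀ X → Σ[ f ∈ Hom X T ] (∀ (g : Hom X T) → g ≈h f)

IsInitial : Graph → Set₁
IsInitial I = ∀ X → Σ[ f ∈ Hom I X ] (∀ (g : Hom I X) → g ≈h f)

IsProduct : {A B Q : Graph} → Hom Q A → Hom Q B → Set₁
IsProduct {A} {B} {Q} π₁ π₂ =
  ∀ X (f : Hom X A) (g : Hom X B) →
    Σ[ h ∈ Hom X Q ] ((π₁ ∘ h ≈h f) × (π₂ ∘ h ≈h g) ×
      (∀ (h' : Hom X Q) → π₁ ∘ h' ≈h f → π₂ ∘ h' ≈h g → h' ≈h h))

IsCoproduct : {A B Q : Graph} → Hom A Q → Hom B Q → Set₁
IsCoproduct {A} {B} {Q} i₁ i₂ =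
  ∀ X (f : Hom A X) (g : Hom B X) →
    Σ[ h ∈ Hom Q X ] ((h ∘ i₁ ≈h f) × (h ∘ i₂ ≈h g) ×
      (∀ (h' : Hom Q X) → h' ∘ i₁ ≈h f → h' ∘ i₂ ≈h g → h' ≈h h))

IsEqualizer : {A B E : Graph} → Hom A B → Hom A B → Hom E A → Set₁
IsEqualizer {A} {B} {E} f g e =
  (f ∘ e ≈h g ∘ e) ×
  (∀ X (k : Hom X A) → f ∘ k ≈h g ∘ k →
    Σ[ u ∈ Hom X E ] ((e ∘ u ≈h k) × (∀ (u' : Hom X E) → e ∘ u' ≈h k → u' ≈h u)))

IsCoequalizer : {A B C : Graph} → Hom A B → Hom A B → Hom B C → Set₁
IsCoequalizer {A} {B} {C} f g c =
  (c ∘ f ≈h c ∘ g) ×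
  (∀ X (k : Hom B X) → k ∘ f ≈h k ∘ g →
    Σ[ u ∈ Hom C X ] ((u ∘ c ≈h k) × (∀ (u' : Hom C X) → u' ∘ c ≈h k → u' ≈h u)))

record Product (A B : Graph) : Set₁ where
  field
    obj       : Graph
    π₁        : Hom obj A
    π₂        : Hom obj B
    isProduct : IsProduct π₁ π₂

  ⟨_,_⟩ : {X : Graph} → Hom X A → Hom X B → Hom X obj
  ⟨_,_⟩ {X} f g = proj₁ (isProduct X f g)

IsMono : {S X : Graph} → Hom S X → Set₁
IsMono {S} {X} m = ∀ Y (g h : Hom Y S) → m ∘ g ≈h m ∘ h → g ≈h h

record Iso (A B : Graph) : Set where
  field
    to    : Hom A B
    from  : Hom B A
    left  : from ∘ to ≈h idH A
    right : to ∘ from ≈h idH B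

IsPullback : {S X T Ω : Graph} → Hom S X → Hom S T → Hom X Ω → Hom T Ω → Set₁
IsPullback {S} {X} {T} {Ω} m p χ t =
  (χ ∘ m ≈h t ∘ p) ×
  (∀ Y (a : Hom Y X) (b : Hom Y T) → χ ∘ a ≈h t ∘ b →
    Σ[ u ∈ Hom Y S ] ((m ∘ u ≈h a) × (p ∘ u ≈h b) ×
      (∀ (u' : Hom Y S) → m ∘ u' ≈h a → p ∘ u' ≈h b → u' ≈h u)))

L1 : Set₁
L1 = (Σ[ T ∈ Graph ] IsTerminal T)
   × (Σ[ I ∈ Graph ] IsInitial I)
   × (∀ A B → Σ[ Q ∈ Graph ] Σ[ π₁ ∈ Hom Q A ] Σ[ π₂ ∈ Hom Q B ] IsProduct π₁ π₂)
   × (∀ A B → Σ[ Q ∈ Graph ] Σ[ i₁ ∈ Hom A Q ] Σ[ i₂ ∈ Hom B Q ] IsCoproduct i₁ i₂)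
   × (∀ A B (f g : Hom A B) → Σ[ E ∈ Graph ] Σ[ e ∈ Hom E A ] IsEqualizer f g e)
   × (∀ A B (f g : Hom A B) → Σ[ C ∈ Graph ] Σ[ c ∈ Hom B C ] IsCoequalizer f g c)

L2 : Set₁
L2 = (Σ[ T ∈ Graph ] IsTerminal T)
   × (Σ[ prod ∈ (∀ A B → Product A B) ]
        (∀ A B → Σ[ BA ∈ Graph ] Σ[ ev ∈ Hom (Product.obj (prod BA A)) B ]
           (∀ X (g : Hom (Product.obj (prod X A)) B) →
              let _×₁_ : Hom X BA → Hom (Product.obj (prod X A)) (Product.obj (prod BA A))
                  _×₁_ = λ k → Product.⟨_,_⟩ (prod BA A) (k ∘ Product.π₁ (prod X A)) (Product.π₂ (prod X A))
              in Σ[ ḡ ∈ Hom X BA ] ((ev ∘ (_×₁_ ḡ) ≈h g) ×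
                   (∀ (ḡ' : Hom X BA) → ev ∘ (_×₁_ ḡ') ≈h g → ḡ' ≈h ḡ)))))

record SubobjectClassifier : Set₁ where
  field
    𝟙          : Graph
    𝟙-terminal : IsTerminal 𝟙
    Ω          : Graph
    ⊤          : Hom 𝟙 Ω
    classify   : ∀ S X (m : Hom S X) → IsMono m →
                   Σ[ χ ∈ Hom X Ω ] (IsPullback m (proj₁ (𝟙-terminal S)) χ ⊤ ×
                     (∀ (χ' : Hom X Ω) → IsPullback m (proj₁ (𝟙-terminal S)) χ' ⊤ → χ' ≈h χ))

L3 : Set₁
L3 = SubobjectClassifier

L4 : Set₁
L4 = Σ[ T ∈ Graph ] Σ[ isT ∈ IsTerminal T ] Σ[ N ∈ Graph ] Σ[ z ∈ Hom T N ] Σ[ σ ∈ Hom N N ]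
       (∀ X (x : Hom T X) (f : Hom X X) →
          Σ[ h ∈ Hom N X ] ((h ∘ z ≈h x) × (h ∘ σ ≈h f ∘ h) ×
            (∀ (h' : Hom N X) → h' ∘ z ≈h x → h' ∘ σ ≈h f ∘ h' → h' ≈h h)))

L5 : Set₁
L5 = ∀ A B (f : Hom A B) → ¬ IsInitial A → Σ[ g ∈ Hom B A ] (f ∘ g ∘ f ≈h f)

L6 : Set₁
L6 = Σ[ soc ∈ SubobjectClassifier ]
       let open SubobjectClassifier soc in
       Σ[ C ∈ Graph ] Σ[ i₁ ∈ Hom 𝟙 C ] Σ[ i₂ ∈ Hom 𝟙 C ] (IsCoproduct i₁ i₂ × Iso Ω C)

-- Limits and colimits are computed on parts: a product pairs parts and, for a pair of edges,
-- records which of the two diagonals is meant; a coequalizer quotients the parts.  Classically,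
-- a subgraph is classified by the graph with vertices inside and outside, a loop at inside (an
-- edge outside the subgraph with both ends in it) and an edge from inside to outside; ℕ is the
-- discrete graph.  The negative results all come from the single edge and its collapse onto a
-- loop: the collapse has no f g f = f partner since the edge has no loop; every map from the edge
-- to 𝟙 + 𝟙 identifies its ends while the classifier separates them; and − × Edge does not
-- preserve the collapse, viewed as the coequalizer of the two ends, so it has no right adjoint.
module Submission where

open import Defs
open import Data.Product using (_×_)
open import Relation.Nullary using (¬_)
open import Axiom.ExcludedMiddle using (ExcludedMiddle)
open import Level using (0ℓ)
open import Data.Bool using (Bool; true; false)
open import Data.Empty using (⊥; ⊥-elim)
open import Data.Nat using (ℕ; zero; suc)
open import Data.Product using (Σ; Σ-syntax; _,_; proj₁; proj₂)
open import Data.Sum using (_⊎_; inj₁; inj₂)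
open import Data.Unit using (⊤; tt)
open import Function using (_on_)
open import Relation.Binary using (Rel; IsEquivalence)
import Relation.Binary.Construct.On as On
open import Relation.Binary.PropositionalEquality as ≡ using (_≡_; refl)
open import Relation.Nullary using (Dec; yes; no; does)
open import Relation.Nullary.Decidable using (dec-true; dec-false)
open import Data.Sum.Relation.Binary.Pointwise using (inj₁; inj₂; ⊎-isEquivalence)
  renaming (Pointwise to ⊎ᴾ)
open import Data.Product.Relation.Binary.Pointwise.NonDependent using (×-isEquivalence)
  renaming (Pointwise to ×ᴾ)

open Graph
open Hom

UEq-isEquivalence : {A : Set} {R : Rel A 0ℓ} → IsEquivalence R → IsEquivalence (UEq R)
UEq-isEquivalence {R = R} isEq = record { refl = inj₁ (r , r) ; sym = sym′ ; trans = trans′ }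
  where
  open IsEquivalence isEq renaming (refl to r; sym to s; trans to t)
  sym′ : ∀ {x y} → UEq R x y → UEq R y x
  sym′ (inj₁ (a , b)) = inj₁ (s a , s b)
  sym′ (inj₂ (a , b)) = inj₂ (s b , s a)
  trans′ : ∀ {x y z} → UEq R x y → UEq R y z → UEq R x z
  trans′ (inj₁ (a , b)) (inj₁ (c , d)) = inj₁ (t a c , t b d)
  trans′ (inj₁ (a , b)) (inj₂ (c , d)) = inj₂ (t a c , t b d)
  trans′ (inj₂ (a , b)) (inj₁ (c , d)) = inj₂ (t a d , t b c)
  trans′ (inj₂ (a , b)) (inj₂ (c , d)) = inj₁ (t a d , t b c)

UEq-map : ∀ {A B : Set} {R : Rel A 0ℓ} (S : Rel B 0ℓ) (F : A → B) →
          (∀ {a b} → R a b → S (F a) (F b)) → ∀ {x y : A × A} →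
          UEq R x y → UEq S (F (proj₁ x) , F (proj₂ x)) (F (proj₁ y) , F (proj₂ y))
UEq-map S F F-cong (inj₁ (a , b)) = inj₁ (F-cong a , F-cong b)
UEq-map S F F-cong (inj₂ (a , b)) = inj₂ (F-cong a , F-cong b)

UEq-unmap : ∀ {A B : Set} (R : Rel A 0ℓ) (S : Rel B 0ℓ) (F : A → B) →
            (∀ {a b} → S (F a) (F b) → R a b) → ∀ {x y : A × A} →
            UEq S (F (proj₁ x) , F (proj₂ x)) (F (proj₁ y) , F (proj₂ y)) → UEq R x y
UEq-unmap R S F F-refl (inj₁ (a , b)) = inj₁ (F-refl a , F-refl b)
UEq-unmap R S F F-refl (inj₂ (a , b)) = inj₂ (F-refl a , F-refl b)

module _ (G : Graph) where
  open IsEquivalence (≈P-equiv G) public using ()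
    renaming (refl to P-refl; sym to P-sym; trans to P-trans)
  open IsEquivalence (≈V-equiv G) public using ()
    renaming (refl to V-refl; sym to V-sym; trans to V-trans)
  open IsEquivalence (UEq-isEquivalence (≈P-equiv G)) public using ()
    renaming (refl to UP-refl; sym to UP-sym; trans to UP-trans)
  open IsEquivalence (UEq-isEquivalence (≈V-equiv G)) public using ()
    renaming (refl to UV-refl)

  ∂₁ ∂₂ : P G → V G
  ∂₁ p = proj₁ (∂ G p)
  ∂₂ p = proj₂ (∂ G p)

  UEq-ι : ∀ {x y} → UEq (_≈V_ G) x y →
          UEq (_≈P_ G) (ι G (proj₁ x) , ι G (proj₂ x)) (ι G (proj₁ y) , ι G (proj₂ y))
  UEq-ι = UEq-map (_≈P_ G) (ι G) (ι-cong G)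

  UEq-ι⁻ : ∀ {x y} → UEq (_≈P_ G) (ι G (proj₁ x) , ι G (proj₂ x)) (ι G (proj₁ y) , ι G (proj₂ y)) →
           UEq (_≈V_ G) x y
  UEq-ι⁻ = UEq-unmap (_≈V_ G) (_≈P_ G) (ι G) (ι-inj G)

  ∂-ι : ∀ v → (_≈P_ G (ι G (∂₁ (ι G v))) (ι G v)) × (_≈P_ G (ι G (∂₂ (ι G v))) (ι G v))
  ∂-ι v with ∂-vertex G v
  ... | inj₁ (a , b) = ι-cong G a , ι-cong G b
  ... | inj₂ (a , b) = ι-cong G a , ι-cong G b

  ∂-vertexPart : ∀ {p w} → _≈P_ G p (ι G w) →
                 (_≈P_ G (ι G (∂₁ p)) p) × (_≈P_ G (ι G (∂₂ p)) p)
  ∂-vertexPart {p} {w} p≈w with UEq-ι (∂-cong G p≈w)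
  ... | inj₁ (a , b) = P-trans a (P-trans (proj₁ (∂-ι w)) (P-sym p≈w)) ,
                       P-trans b (P-trans (proj₂ (∂-ι w)) (P-sym p≈w))
  ... | inj₂ (a , b) = P-trans a (P-trans (proj₂ (∂-ι w)) (P-sym p≈w)) ,
                       P-trans b (P-trans (proj₁ (∂-ι w)) (P-sym p≈w))

module _ {G H : Graph} (f : Hom G H) where
  vmap : V G → V H
  vmap v = proj₁ (vertex f v)

  ι-vmap : ∀ v → _≈P_ H (ι H (vmap v)) (fun f (ι G v))
  ι-vmap v = proj₂ (vertex f v)

  vmap-cong : ∀ {a b} → _≈V_ G a b → _≈V_ H (vmap a) (vmap b)
  vmap-cong a≈b = ι-inj H (P-trans H (ι-vmap _) (P-trans H (cong f (ι-cong G a≈b)) (P-sym H (ι-vmap _))))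

  ∂-fun : ∀ x → UEq (_≈V_ H) (∂ H (fun f x)) (vmap (∂₁ G x) , vmap (∂₂ G x))
  ∂-fun x = UEq-ι⁻ H (UP-trans H (incident f x) (inj₁ (P-sym H (ι-vmap _) , P-sym H (ι-vmap _))))

  Hits : V H → Set
  Hits w = Σ[ v ∈ V G ] _≈V_ H w (vmap v)

  ∂-fun-vmap : ∀ x → Hits (∂₁ H (fun f x)) × Hits (∂₂ H (fun f x))
  ∂-fun-vmap x with ∂-fun x
  ... | inj₁ (a , b) = (_ , a) , (_ , b)
  ... | inj₂ (a , b) = (_ , a) , (_ , b)

mkGraph : (P V : Set) (ι : V → P) → (∀ {u v} → ι u ≡ ι v → u ≡ v) → (∂ : P → V × V) →
          (∀ v → ∂ (ι v) ≡ (v , v)) → Graph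
mkGraph P V ι ι-inj ∂ ∂-ι = record
  { P = P ; _≈P_ = _≡_ ; ≈P-equiv = ≡.isEquivalence
  ; V = V ; _≈V_ = _≡_ ; ≈V-equiv = ≡.isEquivalence
  ; ι = ι ; ι-cong = ≡.cong ι ; ι-inj = ι-inj ; ∂ = ∂
  ; ∂-cong = λ { refl → inj₁ (refl , refl) }
  ; ∂-vertex = λ v → ≡.subst (λ z → UEq _≡_ z (v , v)) (≡.sym (∂-ι v)) (inj₁ (refl , refl)) }

Discrete : Set → Graph
Discrete A = mkGraph A A (λ a → a) (λ e → e) (λ a → a , a) (λ _ → refl)

𝟘ᴳ 𝟙ᴳ 𝟚ᴳ ℕᴳ : Graph
𝟘ᴳ = Discrete ⊥
𝟙ᴳ = Discrete ⊤
𝟚ᴳ = Discrete Bool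
ℕᴳ = Discrete ℕ

data EdgeVertex : Set where
  src tgt : EdgeVertex

data EdgePart : Set where
  src tgt edge : EdgePart

Edge : Graph
Edge = mkGraph EdgePart EdgeVertex ι′ ι′-inj ∂′ (λ { src → refl ; tgt → refl })
  where
  ι′ : EdgeVertex → EdgePart
  ι′ src = src
  ι′ tgt = tgt
  ι′-inj : ∀ {u v} → ι′ u ≡ ι′ v → u ≡ v
  ι′-inj {src} {src} _ = refl
  ι′-inj {tgt} {tgt} _ = refl
  ∂′ : EdgePart → EdgeVertex × EdgeVertex
  ∂′ src = src , src
  ∂′ tgt = tgt , tgt
  ∂′ edge = src , tgt

data LoopPart : Set where
  base loop : LoopPart

Loop : Graph
Loop = mkGraph LoopPart ⊤ (λ _ → base) (λ _ → refl) (λ _ → tt , tt) (λ _ → refl)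

const : (G : Graph) {H : Graph} → V H → Hom G H
const G {H} w = record
  { fun = λ _ → ι H w ; cong = λ _ → P-refl H ; vertex = λ _ → w , P-refl H
  ; incident = λ _ → inj₁ (∂-ι H w) }

! : (G : Graph) → Hom G 𝟙ᴳ
! G = const G tt

𝟙ᴳ-terminal : IsTerminal 𝟙ᴳ
𝟙ᴳ-terminal X = ! X , λ _ _ → refl

atSrc atTgt : Hom 𝟙ᴳ Edge
atSrc = const 𝟙ᴳ src
atTgt = const 𝟙ᴳ tgt

𝟘ᴳ-initial : IsInitial 𝟘ᴳ
𝟘ᴳ-initial X = record { fun = λ () ; cong = λ {} ; vertex = λ () ; incident = λ () } , λ _ ()

edgeMap : (G : Graph) (p : P G) {a b : V G} → UEq (_≈V_ G) (∂ G p) (a , b) → Hom Edge G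
edgeMap G p {a} {b} ends = record
  { fun = f ; cong = λ { refl → P-refl G } ; vertex = vx ; incident = inc }
  where
  f : EdgePart → P G
  f src = ι G a
  f tgt = ι G b
  f edge = p
  vx : ∀ v → Σ[ w ∈ V G ] _≈P_ G (ι G w) (f (ι Edge v))
  vx src = a , P-refl G
  vx tgt = b , P-refl G
  inc : ∀ x → UEq (_≈P_ G) (ι G (∂₁ G (f x)) , ι G (∂₂ G (f x)))
                           (f (ι Edge (∂₁ Edge x)) , f (ι Edge (∂₂ Edge x)))
  inc src = inj₁ (∂-ι G a)
  inc tgt = inj₁ (∂-ι G b)
  inc edge = UEq-ι G ends

terminal-parts-≈ : ∀ {T} → IsTerminal T → ∀ p q → _≈P_ T p q
terminal-parts-≈ {T} isT p q =
  P-trans T (unique (edgeMap T p (UV-refl T)) edge) (P-sym T (unique (edgeMap T q (UV-refl T)) edge))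
  where
  unique = proj₂ (isT Edge)

mono-injective : ∀ {S X} (m : Hom S X) → IsMono m →
                 ∀ {s s'} → _≈P_ X (fun m s) (fun m s') → _≈P_ S s s'
mono-injective {S} {X} m mono {s} {s'} ms≈ms' with
  UP-trans X (UP-sym X (incident m s)) (UP-trans X (UEq-ι X (∂-cong X ms≈ms')) (incident m s'))
... | inj₁ (a , b) = mono Edge (edgeMap S s (UV-refl S))
                               (edgeMap S s' (UV-refl S))
                               (λ { src → a ; tgt → b ; edge → ms≈ms' }) edge
... | inj₂ (a , b) = mono Edge (edgeMap S s (UV-refl S))
                               (edgeMap S s' (inj₂ (V-refl S , V-refl S)))
                               (λ { src → a ; tgt → b ; edge → ms≈ms' }) edge

mono-reflects-vertices : ∀ {S X} (m : Hom S X) → IsMono m →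
                         ∀ {s x} → _≈P_ X (fun m s) (ι X x) → Σ[ w ∈ V S ] _≈P_ S (ι S w) s
mono-reflects-vertices {S} {X} m mono {s} ms≈x = ∂₁ S s , mono-injective m mono (end≈ms (incident m s))
  where
  ends≈ms = ∂-vertexPart X ms≈x
  end≈ms : UEq (_≈P_ X) (ι X (∂₁ X (fun m s)) , ι X (∂₂ X (fun m s)))
                        (fun m (ι S (∂₁ S s)) , fun m (ι S (∂₂ S s)))
           → _≈P_ X (fun m (ι S (∂₁ S s))) (fun m s)
  end≈ms (inj₁ (a , _)) = P-trans X (P-sym X a) (proj₁ ends≈ms)
  end≈ms (inj₂ (_ , b)) = P-trans X (P-sym X b) (proj₂ ends≈ms)

-- Finite limits and colimits

-- A pair of edges spans two parts of the product, told apart by the flag: true for the ends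
-- (a₁,b₁),(a₂,b₂), false for (a₁,b₂),(a₂,b₁).  Parts are equal when their components and
-- their ends are, so the flag only matters for pairs of non-loop edges.
module ProductGraph (A B : Graph) where
  Vertex : Set
  Vertex = V A × V B

  _≈Vx_ : Rel Vertex 0ℓ
  _≈Vx_ = ×ᴾ (_≈V_ A) (_≈V_ B)

  ≈Vx-equiv : IsEquivalence _≈Vx_
  ≈Vx-equiv = ×-isEquivalence (≈V-equiv A) (≈V-equiv B)

  open IsEquivalence (UEq-isEquivalence ≈Vx-equiv) using ()
    renaming (refl to UVx-refl; sym to UVx-sym; trans to UVx-trans)

  Part : Set
  Part = P A × P B × Bool

  ends : Part → Vertex × Vertex
  ends (p , q , true)  = (∂₁ A p , ∂₁ B q) , (∂₂ A p , ∂₂ B q)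
  ends (p , q , false) = (∂₁ A p , ∂₂ B q) , (∂₂ A p , ∂₁ B q)

  _≈Pt_ : Rel Part 0ℓ
  x ≈Pt y = (_≈P_ A (proj₁ x) (proj₁ y)) × (_≈P_ B (proj₁ (proj₂ x)) (proj₁ (proj₂ y)))
            × UEq _≈Vx_ (ends x) (ends y)

  ≈Pt-equiv : IsEquivalence _≈Pt_
  ≈Pt-equiv = record
    { refl = P-refl A , P-refl B , UVx-refl
    ; sym = λ (x , y , z) → P-sym A x , P-sym B y , UVx-sym z
    ; trans = λ (x , y , z) (x' , y' , z') → P-trans A x x' , P-trans B y y' , UVx-trans z z' }

  ιx : Vertex → Part
  ιx (a , b) = ι A a , ι B b , true

  ends-ιx : ∀ v → UEq _≈Vx_ (ends (ιx v)) (v , v)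
  ends-ιx (a , b) with ∂-vertex A a | ∂-vertex B b
  ... | inj₁ (a₁ , a₂) | inj₁ (b₁ , b₂) = inj₁ ((a₁ , b₁) , (a₂ , b₂))
  ... | inj₁ (a₁ , a₂) | inj₂ (b₁ , b₂) = inj₁ ((a₁ , b₁) , (a₂ , b₂))
  ... | inj₂ (a₁ , a₂) | inj₁ (b₁ , b₂) = inj₁ ((a₁ , b₁) , (a₂ , b₂))
  ... | inj₂ (a₁ , a₂) | inj₂ (b₁ , b₂) = inj₁ ((a₁ , b₁) , (a₂ , b₂))

  graph : Graph
  graph = record
    { P = Part ; _≈P_ = _≈Pt_ ; ≈P-equiv = ≈Pt-equiv
    ; V = Vertex ; _≈V_ = _≈Vx_ ; ≈V-equiv = ≈Vx-equiv
    ; ι = ιx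
    ; ι-cong = λ {u} {v} u≈v → ι-cong A (proj₁ u≈v) , ι-cong B (proj₂ u≈v) ,
                 UVx-trans (ends-ιx u) (UVx-trans (inj₁ (u≈v , u≈v)) (UVx-sym (ends-ιx v)))
    ; ι-inj = λ (a , b , _) → ι-inj A a , ι-inj B b
    ; ∂ = ends
    ; ∂-cong = λ (_ , _ , e) → e
    ; ∂-vertex = ends-ιx }

  π₁ : Hom graph A
  π₁ = record { fun = proj₁ ; cong = proj₁ ; vertex = λ v → proj₁ v , P-refl A ; incident = inc }
    where
    inc : ∀ x → UEq (_≈P_ A) (ι A (∂₁ A (proj₁ x)) , ι A (∂₂ A (proj₁ x)))
                             (ι A (proj₁ (proj₁ (ends x))) , ι A (proj₁ (proj₂ (ends x))))
    inc (_ , _ , true) = UP-refl A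
    inc (_ , _ , false) = UP-refl A

  π₂ : Hom graph B
  π₂ = record
    { fun = λ x → proj₁ (proj₂ x) ; cong = λ e → proj₁ (proj₂ e)
    ; vertex = λ v → proj₂ v , P-refl B ; incident = inc }
    where
    inc : ∀ x → UEq (_≈P_ B) (ι B (∂₁ B (proj₁ (proj₂ x))) , ι B (∂₂ B (proj₁ (proj₂ x))))
                             (ι B (proj₂ (proj₁ (ends x))) , ι B (proj₂ (proj₂ (ends x))))
    inc (_ , _ , true) = UP-refl B
    inc (_ , _ , false) = inj₂ (P-refl B , P-refl B)

  sameOrientation : ∀ {S T U W : Set} → S ⊎ T → U ⊎ W → Bool
  sameOrientation (inj₁ _) (inj₁ _) = true
  sameOrientation (inj₂ _) (inj₂ _) = true
  sameOrientation (inj₁ _) (inj₂ _) = false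
  sameOrientation (inj₂ _) (inj₁ _) = false

  module Pairing {X : Graph} (f : Hom X A) (g : Hom X B) where
    vpair : V X → Vertex
    vpair v = vmap f v , vmap g v

    vpair-cong : ∀ {a b} → _≈V_ X a b → vpair a ≈Vx vpair b
    vpair-cong e = vmap-cong f e , vmap-cong g e

    pair : P X → Part
    pair x = fun f x , fun g x , sameOrientation (incident f x) (incident g x)

    ends-pair : ∀ x → UEq _≈Vx_ (ends (pair x)) (vpair (∂₁ X x) , vpair (∂₂ X x))
    ends-pair x = orient (incident f x) (incident g x)
      where
      vf : ∀ {z y} → _≈P_ A (ι A z) (fun f (ι X y)) → _≈V_ A z (vmap f y)
      vf e = ι-inj A (P-trans A e (P-sym A (ι-vmap f _)))
      vg : ∀ {z y} → _≈P_ B (ι B z) (fun g (ι X y)) → _≈V_ B z (vmap g y)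
      vg e = ι-inj B (P-trans B e (P-sym B (ι-vmap g _)))
      orient : ∀ (i₁ : UEq (_≈P_ A) (ι A (∂₁ A (fun f x)) , ι A (∂₂ A (fun f x)))
                                    (fun f (ι X (∂₁ X x)) , fun f (ι X (∂₂ X x))))
                 (i₂ : UEq (_≈P_ B) (ι B (∂₁ B (fun g x)) , ι B (∂₂ B (fun g x)))
                                    (fun g (ι X (∂₁ X x)) , fun g (ι X (∂₂ X x)))) →
               UEq _≈Vx_ (ends (fun f x , fun g x , sameOrientation i₁ i₂))
                         (vpair (∂₁ X x) , vpair (∂₂ X x))
      orient (inj₁ (a , b)) (inj₁ (c , d)) = inj₁ ((vf a , vg c) , (vf b , vg d))
      orient (inj₂ (a , b)) (inj₂ (c , d)) = inj₂ ((vf a , vg c) , (vf b , vg d))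
      orient (inj₁ (a , b)) (inj₂ (c , d)) = inj₁ ((vf a , vg d) , (vf b , vg c))
      orient (inj₂ (a , b)) (inj₁ (c , d)) = inj₂ ((vf a , vg d) , (vf b , vg c))

    ιx≈pair : ∀ {w y} → w ≈Vx vpair y → ιx w ≈Pt pair (ι X y)
    ιx≈pair {w} {y} w≈y =
      P-trans A (ι-cong A (proj₁ w≈y)) (ι-vmap f y) , P-trans B (ι-cong B (proj₂ w≈y)) (ι-vmap g y) ,
      UVx-trans (ends-ιx w) (UVx-trans (inj₁ (to-y (∂₁-ι y) , to-y (∂₂-ι y))) (UVx-sym (ends-pair (ι X y))))
      where
      to-y : ∀ {z} → _≈V_ X z y → w ≈Vx vpair z
      to-y z≈y = IsEquivalence.trans ≈Vx-equiv w≈y (vpair-cong (V-sym X z≈y))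
      ∂₁-ι : ∀ y → _≈V_ X (∂₁ X (ι X y)) y
      ∂₁-ι y = ι-inj X (proj₁ (∂-ι X y))
      ∂₂-ι : ∀ y → _≈V_ X (∂₂ X (ι X y)) y
      ∂₂-ι y = ι-inj X (proj₂ (∂-ι X y))

    ⟨_,_⟩ : Hom X graph
    ⟨_,_⟩ = record
      { fun = pair
      ; cong = λ {x} {y} x≈y → cong f x≈y , cong g x≈y ,
          UVx-trans (ends-pair x)
            (UVx-trans (UEq-map _≈Vx_ vpair vpair-cong (∂-cong X x≈y)) (UVx-sym (ends-pair y)))
      ; vertex = λ v → vpair v , ιx≈pair (IsEquivalence.refl ≈Vx-equiv)
      ; incident = inc }
      where
      inc : ∀ x → UEq _≈Pt_ (ιx (proj₁ (ends (pair x))) , ιx (proj₂ (ends (pair x))))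
                            (pair (ι X (∂₁ X x)) , pair (ι X (∂₂ X x)))
      inc x with ends-pair x
      ... | inj₁ (a , b) = inj₁ (ιx≈pair a , ιx≈pair b)
      ... | inj₂ (a , b) = inj₂ (ιx≈pair a , ιx≈pair b)

    unique : ∀ (h : Hom X graph) → π₁ ∘ h ≈h f → π₂ ∘ h ≈h g → h ≈h ⟨_,_⟩
    unique h π₁h≈f π₂h≈g x = π₁h≈f x , π₂h≈g x ,
      UVx-trans (∂-fun h x) (UVx-trans (inj₁ (vh≈vpair (∂₁ X x) , vh≈vpair (∂₂ X x))) (UVx-sym (ends-pair x)))
      where
      vh≈vpair : ∀ y → vmap h y ≈Vx vpair y
      vh≈vpair y =
        ι-inj A (P-trans A (proj₁ (ι-vmap h y)) (P-trans A (π₁h≈f (ι X y)) (P-sym A (ι-vmap f y)))) ,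
        ι-inj B (P-trans B (proj₁ (proj₂ (ι-vmap h y))) (P-trans B (π₂h≈g (ι X y)) (P-sym B (ι-vmap g y))))

  open Pairing public using (⟨_,_⟩)

  isProduct : IsProduct π₁ π₂
  isProduct X f g = ⟨ f , g ⟩ , (λ _ → P-refl A) , (λ _ → P-refl B) , Pairing.unique f g

_×ᴳ_ : Graph → Graph → Graph
A ×ᴳ B = ProductGraph.graph A B

module CoproductGraph (A B : Graph) where
  ι⊎ : V A ⊎ V B → P A ⊎ P B
  ι⊎ (inj₁ v) = inj₁ (ι A v)
  ι⊎ (inj₂ v) = inj₂ (ι B v)

  ∂⊎ : P A ⊎ P B → (V A ⊎ V B) × (V A ⊎ V B)
  ∂⊎ (inj₁ p) = inj₁ (∂₁ A p) , inj₁ (∂₂ A p)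
  ∂⊎ (inj₂ p) = inj₂ (∂₁ B p) , inj₂ (∂₂ B p)

  graph : Graph
  graph = record
    { P = P A ⊎ P B ; _≈P_ = ⊎ᴾ (_≈P_ A) (_≈P_ B) ; ≈P-equiv = ⊎-isEquivalence (≈P-equiv A) (≈P-equiv B)
    ; V = V A ⊎ V B ; _≈V_ = ⊎ᴾ (_≈V_ A) (_≈V_ B) ; ≈V-equiv = ⊎-isEquivalence (≈V-equiv A) (≈V-equiv B)
    ; ι = ι⊎
    ; ι-cong = λ { (inj₁ e) → inj₁ (ι-cong A e) ; (inj₂ e) → inj₂ (ι-cong B e) }
    ; ι-inj = λ { {inj₁ _} {inj₁ _} (inj₁ e) → inj₁ (ι-inj A e)
                ; {inj₂ _} {inj₂ _} (inj₂ e) → inj₂ (ι-inj B e) }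
    ; ∂ = ∂⊎
    ; ∂-cong = λ { (inj₁ e) → UEq-map (⊎ᴾ (_≈V_ A) (_≈V_ B)) inj₁ inj₁ (∂-cong A e)
                 ; (inj₂ e) → UEq-map (⊎ᴾ (_≈V_ A) (_≈V_ B)) inj₂ inj₂ (∂-cong B e) }
    ; ∂-vertex = λ { (inj₁ v) → UEq-map (⊎ᴾ (_≈V_ A) (_≈V_ B)) inj₁ inj₁ (∂-vertex A v)
                   ; (inj₂ v) → UEq-map (⊎ᴾ (_≈V_ A) (_≈V_ B)) inj₂ inj₂ (∂-vertex B v) } }

  i₁ : Hom A graph
  i₁ = record
    { fun = inj₁ ; cong = inj₁ ; vertex = λ v → inj₁ v , inj₁ (P-refl A) ; incident = λ _ → UP-refl graph }

  i₂ : Hom B graph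
  i₂ = record
    { fun = inj₂ ; cong = inj₂ ; vertex = λ v → inj₂ v , inj₂ (P-refl B) ; incident = λ _ → UP-refl graph }

  isCoproduct : IsCoproduct i₁ i₂
  isCoproduct X f g = [f,g] , (λ _ → P-refl X) , (λ _ → P-refl X) , unique
    where
    [f,g] : Hom graph X
    [f,g] = record
      { fun = λ { (inj₁ p) → fun f p ; (inj₂ q) → fun g q }
      ; cong = λ { (inj₁ e) → cong f e ; (inj₂ e) → cong g e }
      ; vertex = λ { (inj₁ v) → vertex f v ; (inj₂ v) → vertex g v }
      ; incident = λ { (inj₁ p) → incident f p ; (inj₂ q) → incident g q } }
    unique : ∀ (h : Hom graph X) → h ∘ i₁ ≈h f → h ∘ i₂ ≈h g → h ≈h [f,g]
    unique h hi₁≈f hi₂≈g (inj₁ p) = hi₁≈f p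
    unique h hi₁≈f hi₂≈g (inj₂ q) = hi₂≈g q

-- A part belongs to the equalizer only together with its ends, so that ∂ restricts to it.
module EqualizerGraph {A B : Graph} (f g : Hom A B) where
  Agree : P A → Set
  Agree p = _≈P_ B (fun f p) (fun g p)

  Agree-cong : ∀ {p q} → _≈P_ A p q → Agree q → Agree p
  Agree-cong p≈q fq≈gq = P-trans B (cong f p≈q) (P-trans B fq≈gq (P-sym B (cong g p≈q)))

  Part : Set
  Part = Σ[ p ∈ P A ] Agree p × Agree (ι A (∂₁ A p)) × Agree (ι A (∂₂ A p))

  Vertex : Set
  Vertex = Σ[ v ∈ V A ] Agree (ι A v)

  ιE : Vertex → Part
  ιE (v , agr) = ι A v , agr , Agree-cong (proj₁ (∂-ι A v)) agr , Agree-cong (proj₂ (∂-ι A v)) agr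

  graph : Graph
  graph = record
    { P = Part ; _≈P_ = _≈P_ A on proj₁ ; ≈P-equiv = On.isEquivalence proj₁ (≈P-equiv A)
    ; V = Vertex ; _≈V_ = _≈V_ A on proj₁ ; ≈V-equiv = On.isEquivalence proj₁ (≈V-equiv A)
    ; ι = ιE ; ι-cong = ι-cong A ; ι-inj = ι-inj A
    ; ∂ = λ (p , _ , agr₁ , agr₂) → (∂₁ A p , agr₁) , (∂₂ A p , agr₂)
    ; ∂-cong = ∂-cong A
    ; ∂-vertex = λ v → ∂-vertex A (proj₁ v) }

  e : Hom graph A
  e = record { fun = proj₁ ; cong = λ x → x ; vertex = λ v → proj₁ v , P-refl A ; incident = λ _ → UP-refl A }

  isEqualizer : IsEqualizer f g e
  isEqualizer = (λ x → proj₁ (proj₂ x)) , universal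
    where
    universal : ∀ X (k : Hom X A) → f ∘ k ≈h g ∘ k →
      Σ[ u ∈ Hom X graph ] ((e ∘ u ≈h k) × (∀ (u' : Hom X graph) → e ∘ u' ≈h k → u' ≈h u))
    universal X k fk≈gk = u , (λ _ → P-refl A) , (λ _ eu'≈k x → eu'≈k x)
      where
      agree-at : ∀ {z y} → _≈P_ A z (fun k y) → Agree z
      agree-at z≈ky = Agree-cong z≈ky (fk≈gk _)
      agree-ends : ∀ x → Agree (ι A (∂₁ A (fun k x))) × Agree (ι A (∂₂ A (fun k x)))
      agree-ends x with incident k x
      ... | inj₁ (a , b) = agree-at a , agree-at b
      ... | inj₂ (a , b) = agree-at a , agree-at b
      u : Hom X graph
      u = record { fun = λ x → fun k x , fk≈gk x , agree-ends x ; cong = cong k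
                 ; vertex = λ v → (vmap k v , agree-at (ι-vmap k v)) , ι-vmap k v
                 ; incident = incident k }

module CoequalizerGraph {A B : Graph} (f g : Hom A B) where
  data _~_ : P B → P B → Set where
    ≈⇒~    : ∀ {p q} → _≈P_ B p q → p ~ q
    f~g    : ∀ a → fun f a ~ fun g a
    ~-sym   : ∀ {p q} → p ~ q → q ~ p
    ~-trans : ∀ {p q r} → p ~ q → q ~ r → p ~ r

  ~-equiv : IsEquivalence _~_
  ~-equiv = record { refl = ≈⇒~ (P-refl B) ; sym = ~-sym ; trans = ~-trans }

  _~V_ : Rel (V B) 0ℓ
  v ~V w = ι B v ~ ι B w

  ~V-equiv : IsEquivalence _~V_
  ~V-equiv = record { refl = ≈⇒~ (P-refl B) ; sym = ~-sym ; trans = ~-trans }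

  open IsEquivalence (UEq-isEquivalence ~-equiv) using ()
    renaming (sym to U~-sym; trans to U~-trans)
  open IsEquivalence (UEq-isEquivalence ~V-equiv) using ()
    renaming (sym to U~V-sym; trans to U~V-trans)

  ≈V⇒~V : ∀ {x y} → UEq (_≈V_ B) x y → UEq _~V_ x y
  ≈V⇒~V = UEq-map _~V_ (λ v → v) (λ e → ≈⇒~ (ι-cong B e))

  ∂-cong~ : ∀ {p q} → p ~ q → UEq _~V_ (∂ B p) (∂ B q)
  ∂-cong~ (≈⇒~ e) = ≈V⇒~V (∂-cong B e)
  ∂-cong~ (f~g a) =
    U~-trans (lift (incident f a)) (U~-trans (inj₁ (f~g _ , f~g _)) (U~-sym (lift (incident g a))))
    where
    lift : ∀ {x y} → UEq (_≈P_ B) x y → UEq _~_ x y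
    lift = UEq-map _~_ (λ p → p) ≈⇒~
  ∂-cong~ (~-sym e) = U~V-sym (∂-cong~ e)
  ∂-cong~ (~-trans e e') = U~V-trans (∂-cong~ e) (∂-cong~ e')

  graph : Graph
  graph = record
    { P = P B ; _≈P_ = _~_ ; ≈P-equiv = ~-equiv ; V = V B ; _≈V_ = _~V_ ; ≈V-equiv = ~V-equiv
    ; ι = ι B ; ι-cong = λ e → e ; ι-inj = λ e → e ; ∂ = ∂ B ; ∂-cong = ∂-cong~
    ; ∂-vertex = λ v → ≈V⇒~V (∂-vertex B v) }

  c : Hom B graph
  c = record
    { fun = λ p → p ; cong = ≈⇒~ ; vertex = λ v → v , ≈⇒~ (P-refl B) ; incident = λ _ → UP-refl graph }

  isCoequalizer : IsCoequalizer f g c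
  isCoequalizer = f~g , universal
    where
    universal : ∀ X (k : Hom B X) → k ∘ f ≈h k ∘ g →
      Σ[ u ∈ Hom graph X ] ((u ∘ c ≈h k) × (∀ (u' : Hom graph X) → u' ∘ c ≈h k → u' ≈h u))
    universal X k kf≈kg = u , (λ _ → P-refl X) , (λ _ u'c≈k p → u'c≈k p)
      where
      k-cong : ∀ {p q} → p ~ q → _≈P_ X (fun k p) (fun k q)
      k-cong (≈⇒~ e) = cong k e
      k-cong (f~g a) = kf≈kg a
      k-cong (~-sym e) = P-sym X (k-cong e)
      k-cong (~-trans e e') = P-trans X (k-cong e) (k-cong e')
      u : Hom graph X
      u = record { fun = fun k ; cong = k-cong ; vertex = vertex k ; incident = incident k }

product-ext : ∀ {A B Q} (π₁ : Hom Q A) (π₂ : Hom Q B) → IsProduct π₁ π₂ →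
              ∀ {Y} (h h' : Hom Y Q) → π₁ ∘ h ≈h π₁ ∘ h' → π₂ ∘ h ≈h π₂ ∘ h' → h ≈h h'
product-ext {A} {B} {Q} π₁ π₂ isProd {Y} h h' π₁h≈π₁h' π₂h≈π₂h' y =
  P-trans Q (unique h π₁h≈π₁h' π₂h≈π₂h' y) (P-sym Q (unique h' (λ _ → P-refl A) (λ _ → P-refl B) y))
  where
  unique = proj₂ (proj₂ (proj₂ (isProd Y (π₁ ∘ h') (π₂ ∘ h'))))

coproduct-ext : ∀ {A B Q} (i₁ : Hom A Q) (i₂ : Hom B Q) → IsCoproduct i₁ i₂ →
                ∀ {Y} (h h' : Hom Q Y) → h ∘ i₁ ≈h h' ∘ i₁ → h ∘ i₂ ≈h h' ∘ i₂ → h ≈h h'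
coproduct-ext {Q = Q} i₁ i₂ isCop {Y} h h' hi₁≈h'i₁ hi₂≈h'i₂ q =
  P-trans Y (unique h hi₁≈h'i₁ hi₂≈h'i₂ q) (P-sym Y (unique h' (λ _ → P-refl Y) (λ _ → P-refl Y) q))
  where
  unique = proj₂ (proj₂ (proj₂ (isCop Y (h' ∘ i₁) (h' ∘ i₂))))

finite-limits-colimits : L1
finite-limits-colimits =
    (𝟙ᴳ , 𝟙ᴳ-terminal) , (𝟘ᴳ , 𝟘ᴳ-initial)
  , (λ A B → A ×ᴳ B , ProductGraph.π₁ A B , ProductGraph.π₂ A B , ProductGraph.isProduct A B)
  , (λ A B → CoproductGraph.graph A B , CoproductGraph.i₁ A B , CoproductGraph.i₂ A B
           , CoproductGraph.isCoproduct A B)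
  , (λ A B f g → EqualizerGraph.graph f g , EqualizerGraph.e f g , EqualizerGraph.isEqualizer f g)
  , (λ A B f g → CoequalizerGraph.graph f g , CoequalizerGraph.c f g , CoequalizerGraph.isCoequalizer f g)

-- The subobject classifier

data ΩVertex : Set where
  inside outside : ΩVertex

-- A part outside a subgraph is a chord when both its ends are inside and a cut when exactly one is.
data ΩPart : Set where
  inside outside chord cut : ΩPart

ιΩ : ΩVertex → ΩPart
ιΩ inside = inside
ιΩ outside = outside

∂Ω : ΩPart → ΩVertex × ΩVertex
∂Ω inside = inside , inside
∂Ω outside = outside , outside
∂Ω chord = inside , inside
∂Ω cut = inside , outside

Ωᴳ : Graph
Ωᴳ = mkGraph ΩPart ΩVertex ιΩ ιΩ-inj ∂Ω (λ { inside → refl ; outside → refl })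
  where
  ιΩ-inj : ∀ {u v} → ιΩ u ≡ ιΩ v → u ≡ v
  ιΩ-inj {inside} {inside} _ = refl
  ιΩ-inj {outside} {outside} _ = refl

trueΩ : Hom 𝟙ᴳ Ωᴳ
trueΩ = const 𝟙ᴳ inside

Ωᴳ-ends : ΩPart → ΩPart × ΩPart
Ωᴳ-ends p = ιΩ (proj₁ (∂Ω p)) , ιΩ (proj₂ (∂Ω p))

-- The arguments say whether the part, its first end and its second end lie in the subgraph.
classifyPart : Bool → Bool → Bool → ΩPart
classifyPart true _ _ = inside
classifyPart false true true = chord
classifyPart false true false = cut
classifyPart false false true = cut
classifyPart false false false = outside

classifyPart-swap : ∀ b x y → classifyPart b x y ≡ classifyPart b y x
classifyPart-swap true x y = refl
classifyPart-swap false true true = refl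
classifyPart-swap false true false = refl
classifyPart-swap false false true = refl
classifyPart-swap false false false = refl

classifyPart-inside : ∀ {b x y} → classifyPart b x y ≡ inside → b ≡ true
classifyPart-inside {true} _ = refl
classifyPart-inside {false} {true} {true} ()
classifyPart-inside {false} {true} {false} ()
classifyPart-inside {false} {false} {true} ()
classifyPart-inside {false} {false} {false} ()

classifyVertex : Bool → ΩVertex
classifyVertex true = inside
classifyVertex false = outside

ιΩ-classifyVertex : ∀ b → ιΩ (classifyVertex b) ≡ classifyPart b b b
ιΩ-classifyVertex true = refl
ιΩ-classifyVertex false = refl

classifyPart-ends : ∀ b x y → (b ≡ true → (x ≡ true) × (y ≡ true)) →
  UEq _≡_ (Ωᴳ-ends (classifyPart b x y)) (classifyPart x x x , classifyPart y y y)
classifyPart-ends true x y closed with closed refl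
... | refl , refl = inj₁ (refl , refl)
classifyPart-ends false true true _ = inj₁ (refl , refl)
classifyPart-ends false true false _ = inj₁ (refl , refl)
classifyPart-ends false false true _ = inj₂ (refl , refl)
classifyPart-ends false false false _ = inj₁ (refl , refl)

Ωᴳ-ends-injective : ∀ x y → ¬ x ≡ inside → ¬ y ≡ inside → UEq _≡_ (Ωᴳ-ends x) (Ωᴳ-ends y) → x ≡ y
Ωᴳ-ends-injective inside _ x≢in _ _ = ⊥-elim (x≢in refl)
Ωᴳ-ends-injective _ inside _ y≢in _ = ⊥-elim (y≢in refl)
Ωᴳ-ends-injective outside outside _ _ _ = refl
Ωᴳ-ends-injective outside chord _ _ (inj₁ (() , _))
Ωᴳ-ends-injective outside chord _ _ (inj₂ (() , _))
Ωᴳ-ends-injective outside cut _ _ (inj₁ (() , _))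
Ωᴳ-ends-injective outside cut _ _ (inj₂ (_ , ()))
Ωᴳ-ends-injective chord outside _ _ (inj₁ (() , _))
Ωᴳ-ends-injective chord outside _ _ (inj₂ (() , _))
Ωᴳ-ends-injective chord chord _ _ _ = refl
Ωᴳ-ends-injective chord cut _ _ (inj₁ (_ , ()))
Ωᴳ-ends-injective chord cut _ _ (inj₂ (() , _))
Ωᴳ-ends-injective cut outside _ _ (inj₁ (() , _))
Ωᴳ-ends-injective cut outside _ _ (inj₂ (() , _))
Ωᴳ-ends-injective cut chord _ _ (inj₁ (_ , ()))
Ωᴳ-ends-injective cut chord _ _ (inj₂ (_ , ()))
Ωᴳ-ends-injective cut cut _ _ _ = refl

inside-ends : ∀ {X} (χ : Hom X Ωᴳ) p → fun χ p ≡ inside →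
              (fun χ (ι X (∂₁ X p)) ≡ inside) × (fun χ (ι X (∂₂ X p)) ≡ inside)
inside-ends χ p χp≡in with fun χ p | incident χ p
inside-ends χ p refl | .inside | inj₁ (a , b) = ≡.sym a , ≡.sym b
inside-ends χ p refl | .inside | inj₂ (a , b) = ≡.sym b , ≡.sym a

true≢false : ¬ true ≡ false
true≢false ()

module Classify (em : ExcludedMiddle 0ℓ) {S X : Graph} (m : Hom S X) (mono : IsMono m) where
  InImage : P X → Set
  InImage p = Σ[ s ∈ P S ] _≈P_ X (fun m s) p

  InImage-cong : ∀ {p q} → _≈P_ X p q → InImage p → InImage q
  InImage-cong p≈q (s , ms≈p) = s , P-trans X ms≈p p≈q

  InImage-ends : ∀ {p} → InImage p → InImage (ι X (∂₁ X p)) × InImage (ι X (∂₂ X p))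
  InImage-ends (s , ms≈p) with UP-trans X (UP-sym X (UEq-ι X (∂-cong X ms≈p))) (incident m s)
  ... | inj₁ (a , b) = (ι S (∂₁ S s) , P-sym X a) , (ι S (∂₂ S s) , P-sym X b)
  ... | inj₂ (a , b) = (ι S (∂₂ S s) , P-sym X a) , (ι S (∂₁ S s) , P-sym X b)

  ∈? : P X → Bool
  ∈? p = does (em {InImage p})

  ∈?-true : ∀ {p} → InImage p → ∈? p ≡ true
  ∈?-true = dec-true em

  ∈?-false : ∀ {p} → ¬ InImage p → ∈? p ≡ false
  ∈?-false = dec-false em

  ∈?-witness : ∀ {p} → ∈? p ≡ true → InImage p
  ∈?-witness = witness em
    where
    witness : ∀ {A : Set} (a? : Dec A) → does a? ≡ true → A
    witness (yes a) _ = a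

  ∈?-cong : ∀ {p q} → _≈P_ X p q → ∈? p ≡ ∈? q
  ∈?-cong {p} {q} p≈q with ∈? p in e
  ... | true = ≡.sym (∈?-true (InImage-cong p≈q (∈?-witness e)))
  ... | false = ≡.sym (∈?-false λ q∈ →
                  true≢false (≡.trans (≡.sym (∈?-true (InImage-cong (P-sym X p≈q) q∈))) e))

  χfun : P X → ΩPart
  χfun p = classifyPart (∈? p) (∈? (ι X (∂₁ X p))) (∈? (ι X (∂₂ X p)))

  χfun-ι : ∀ {v b} → ∈? (ι X v) ≡ b → χfun (ι X v) ≡ ιΩ (classifyVertex b)
  χfun-ι {v} refl rewrite ∈?-cong (proj₁ (∂-ι X v)) | ∈?-cong (proj₂ (∂-ι X v)) =
    ≡.sym (ιΩ-classifyVertex (∈? (ι X v)))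

  χfun-cong : ∀ {p q} → _≈P_ X p q → χfun p ≡ χfun q
  χfun-cong {p} {q} p≈q with ∂-cong X p≈q
  ... | inj₁ (a , b) rewrite ∈?-cong p≈q | ∈?-cong (ι-cong X a) | ∈?-cong (ι-cong X b) = refl
  ... | inj₂ (a , b) rewrite ∈?-cong p≈q | ∈?-cong (ι-cong X a) | ∈?-cong (ι-cong X b) =
    classifyPart-swap _ _ _

  χ : Hom X Ωᴳ
  χ = record { fun = χfun ; cong = χfun-cong ; vertex = vx ; incident = inc }
    where
    vx : ∀ v → Σ[ w ∈ ΩVertex ] ιΩ w ≡ χfun (ι X v)
    vx v = classifyVertex (∈? (ι X v)) , ≡.sym (χfun-ι refl)
    ends-∈? : ∀ p → ∈? p ≡ true → (∈? (ι X (∂₁ X p)) ≡ true) × (∈? (ι X (∂₂ X p)) ≡ true)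
    ends-∈? p p∈ = ∈?-true (proj₁ (InImage-ends (∈?-witness p∈))) ,
                   ∈?-true (proj₂ (InImage-ends (∈?-witness p∈)))
    inc : ∀ p → UEq _≡_ (Ωᴳ-ends (χfun p)) (χfun (ι X (∂₁ X p)) , χfun (ι X (∂₂ X p)))
    inc p rewrite χfun-ι {∂₁ X p} refl | χfun-ι {∂₂ X p} refl
                | ιΩ-classifyVertex (∈? (ι X (∂₁ X p))) | ιΩ-classifyVertex (∈? (ι X (∂₂ X p))) =
      classifyPart-ends (∈? p) (∈? (ι X (∂₁ X p))) (∈? (ι X (∂₂ X p))) (ends-∈? p)

  χ-pullback : IsPullback m (! S) χ trueΩ
  χ-pullback = commutes , universal
    where
    commutes : χ ∘ m ≈h trueΩ ∘ ! S
    commutes s rewrite ∈?-true {fun m s} (s , P-refl X) = refl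
    universal : ∀ Y (a : Hom Y X) (b : Hom Y 𝟙ᴳ) → χ ∘ a ≈h trueΩ ∘ b →
      Σ[ u ∈ Hom Y S ] ((m ∘ u ≈h a) × (! S ∘ u ≈h b) ×
        (∀ (u' : Hom Y S) → m ∘ u' ≈h a → ! S ∘ u' ≈h b → u' ≈h u))
    universal Y a b χa≡true = u , mu≈a , (λ _ → refl) , unique
      where
      preimage : ∀ y → InImage (fun a y)
      preimage y = ∈?-witness (classifyPart-inside (χa≡true y))
      mu≈a : ∀ y → _≈P_ X (fun m (proj₁ (preimage y))) (fun a y)
      mu≈a y = proj₂ (preimage y)
      injective = mono-injective m mono
      u : Hom Y S
      u = record
        { fun = λ y → proj₁ (preimage y)
        ; cong = λ {y} {y'} y≈y' →
            injective (P-trans X (mu≈a y) (P-trans X (cong a y≈y') (P-sym X (mu≈a y'))))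
        ; vertex = λ v → mono-reflects-vertices m mono (P-trans X (mu≈a (ι Y v)) (P-sym X (ι-vmap a v)))
        ; incident = λ y → UEq-unmap (_≈P_ S) (_≈P_ X) (fun m) injective
            (UP-trans X (UP-sym X (incident m _))
              (UP-trans X (UEq-ι X (∂-cong X (mu≈a y)))
                (UP-trans X (incident a y) (inj₁ (P-sym X (mu≈a _) , P-sym X (mu≈a _)))))) }
      unique : ∀ (u' : Hom Y S) → m ∘ u' ≈h a → ! S ∘ u' ≈h b → u' ≈h u
      unique u' mu'≈a _ y = injective (P-trans X (mu'≈a y) (P-sym X (mu≈a y)))

  module _ (χ' : Hom X Ωᴳ) (χ'-pullback : IsPullback m (! S) χ' trueΩ) where
    χ'-inside : ∀ p → ∈? p ≡ true → fun χ' p ≡ inside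
    χ'-inside p p∈ with ∈?-witness p∈
    ... | s , ms≈p = ≡.trans (≡.sym (cong χ' ms≈p)) (proj₁ χ'-pullback s)

    -- An edge sent inside, together with its ends, is a cone over the pullback, hence in the image.
    χ'-not-inside : ∀ p → ∈? p ≡ false → ¬ fun χ' p ≡ inside
    χ'-not-inside p p∉ χ'p≡in =
      true≢false (≡.trans (≡.sym (∈?-true (fun u edge , proj₁ (proj₂ cone) edge))) p∉)
      where
      χ'e≡true : χ' ∘ edgeMap X p (UV-refl X) ≈h trueΩ ∘ ! Edge
      χ'e≡true src = proj₁ (inside-ends χ' p χ'p≡in)
      χ'e≡true tgt = proj₂ (inside-ends χ' p χ'p≡in)
      χ'e≡true edge = χ'p≡in
      cone = proj₂ χ'-pullback Edge (edgeMap X p (UV-refl X)) (! Edge) χ'e≡true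
      u = proj₁ cone

    χ'≈χ-on-vertices : ∀ v → fun χ' (ι X v) ≡ χfun (ι X v)
    χ'≈χ-on-vertices v = by-cases (∈? (ι X v)) refl (vertex χ' v)
      where
      by-cases : ∀ b → ∈? (ι X v) ≡ b → Σ[ w ∈ ΩVertex ] ιΩ w ≡ fun χ' (ι X v) →
                 fun χ' (ι X v) ≡ χfun (ι X v)
      by-cases true  e _             = ≡.trans (χ'-inside (ι X v) e) (≡.sym (χfun-ι e))
      by-cases false e (inside , w)  = ⊥-elim (χ'-not-inside (ι X v) e (≡.sym w))
      by-cases false e (outside , w) = ≡.trans (≡.sym w) (≡.sym (χfun-ι e))

    χ-unique : χ' ≈h χ
    χ-unique p = by-cases (∈? p) refl
      where
      ends≡ : UEq _≡_ (Ωᴳ-ends (fun χ' p)) (Ωᴳ-ends (χfun p))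
      ends≡ = UP-trans Ωᴳ (incident χ' p)
                (UP-trans Ωᴳ (inj₁ (χ'≈χ-on-vertices (∂₁ X p) , χ'≈χ-on-vertices (∂₂ X p)))
                  (UP-sym Ωᴳ (incident χ p)))
      by-cases : ∀ b → ∈? p ≡ b → fun χ' p ≡ χfun p
      by-cases true e =
        ≡.trans (χ'-inside p e) (≡.sym (≡.cong (λ b → classifyPart b (∈? (ι X (∂₁ X p))) (∈? (ι X (∂₂ X p)))) e))
      by-cases false e = Ωᴳ-ends-injective (fun χ' p) (χfun p) (χ'-not-inside p e) χp≢in ends≡
        where
        χp≢in : ¬ χfun p ≡ inside
        χp≢in χp≡in = true≢false (≡.trans (≡.sym (classifyPart-inside χp≡in)) e)

subobject-classifier : ExcludedMiddle 0ℓ → SubobjectClassifier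
subobject-classifier em = record
  { 𝟙 = 𝟙ᴳ ; 𝟙-terminal = 𝟙ᴳ-terminal ; Ω = Ωᴳ ; ⊤ = trueΩ
  ; classify = λ S X m mono → let open Classify em m mono in χ , χ-pullback , χ-unique }

-- The natural number object

zeroᴺ : Hom 𝟙ᴳ ℕᴳ
zeroᴺ = const 𝟙ᴳ 0

sucᴺ : Hom ℕᴳ ℕᴳ
sucᴺ = record
  { fun = suc ; cong = ≡.cong suc ; vertex = λ n → suc n , refl ; incident = λ _ → inj₁ (refl , refl) }

module Recursion {X : Graph} (x : Hom 𝟙ᴳ X) (f : Hom X X) where
  iterate : ℕ → P X
  iterate zero = fun x tt
  iterate (suc n) = fun f (iterate n)

  iterate-vertex : ∀ n → Σ[ w ∈ V X ] _≈P_ X (ι X w) (iterate n)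
  iterate-vertex zero = vertex x tt
  iterate-vertex (suc n) with iterate-vertex n
  ... | w , w≈ = vmap f w , P-trans X (ι-vmap f w) (cong f w≈)

  rec : Hom ℕᴳ X
  rec = record
    { fun = iterate ; cong = λ { refl → P-refl X } ; vertex = iterate-vertex
    ; incident = λ n → inj₁ (∂-vertexPart X (P-sym X (proj₂ (iterate-vertex n)))) }

  rec-unique : ∀ (h : Hom ℕᴳ X) → h ∘ zeroᴺ ≈h x → h ∘ sucᴺ ≈h f ∘ h → h ≈h rec
  rec-unique h h0≈x hs≈fh zero = h0≈x tt
  rec-unique h h0≈x hs≈fh (suc n) = P-trans X (hs≈fh n) (cong f (rec-unique h h0≈x hs≈fh n))

natural-number-object : L4
natural-number-object = 𝟙ᴳ , 𝟙ᴳ-terminal , ℕᴳ , zeroᴺ , sucᴺ ,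
  λ X x f → Recursion.rec x f , (λ _ → P-refl X) , (λ _ → P-refl X) , Recursion.rec-unique x f

-- Failure of choice

collapse : Hom Edge Loop
collapse = record { fun = c ; cong = λ { refl → refl } ; vertex = λ v → tt , c-ι v ; incident = inc }
  where
  c : EdgePart → LoopPart
  c edge = loop
  c _ = base
  c-ι : ∀ v → base ≡ c (ι Edge v)
  c-ι src = refl
  c-ι tgt = refl
  inc : ∀ p → UEq _≡_ (base , base) (c (ι Edge (∂₁ Edge p)) , c (ι Edge (∂₂ Edge p)))
  inc src = inj₁ (refl , refl)
  inc tgt = inj₁ (refl , refl)
  inc edge = inj₁ (refl , refl)

collapse⁻¹-loop : ∀ p → fun collapse p ≡ loop → p ≡ edge
collapse⁻¹-loop edge _ = refl

Edge-loopless : ∀ (g : Hom Loop Edge) → ¬ fun g loop ≡ edge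
Edge-loopless g gℓ≡e =
  src≢tgt (≡.subst (λ p → UEq _≡_ (Edge-ends p) (fun g base , fun g base)) gℓ≡e (incident g loop))
  where
  Edge-ends : EdgePart → EdgePart × EdgePart
  Edge-ends p = ι Edge (∂₁ Edge p) , ι Edge (∂₂ Edge p)
  src≢tgt : ∀ {q} → ¬ UEq _≡_ (src , tgt) (q , q)
  src≢tgt (inj₁ (refl , ()))
  src≢tgt (inj₂ (refl , ()))

Edge-not-initial : ¬ IsInitial Edge
Edge-not-initial isI
  with ≡.trans (proj₂ (isI Edge) (idH Edge) tgt) (≡.sym (proj₂ (isI Edge) (const Edge src) tgt))
... | ()

no-choice : ¬ L5
no-choice choice = Edge-loopless g (collapse⁻¹-loop (fun g loop) (cgc≈c edge))
  where
  g = proj₁ (choice Edge Loop collapse Edge-not-initial)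
  cgc≈c = proj₂ (choice Edge Loop collapse Edge-not-initial)

-- Failure of two-valuedness

point-mono : ∀ {X} (x : Hom 𝟙ᴳ X) → IsMono x
point-mono x Y g h _ p = refl

Edge→𝟚ᴳ-constant : ∀ (k : Hom Edge 𝟚ᴳ) → fun k src ≡ fun k tgt
Edge→𝟚ᴳ-constant k with incident k edge
... | inj₁ (a , b) = ≡.trans (≡.sym a) b
... | inj₂ (a , b) = ≡.trans (≡.sym b) a

module _ (em : ExcludedMiddle 0ℓ) {C : Graph} (x : V C) where
  open Classify em (const 𝟙ᴳ {C} x) (point-mono {C} (const 𝟙ᴳ x)) using (χ; InImage; ∈?-true; ∈?-false)

  module _ {D} (f : Hom D C) (¬hit : ¬ Hits f x) where
    vertex-image-avoided : ∀ {q} → Hits f q → ¬ InImage (ι C q)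
    vertex-image-avoided (v , q≈fv) (_ , x≈q) = ¬hit (v , V-trans C (ι-inj C x≈q) q≈fv)

    -- A part at the vertex x is a vertex, so its ends are x as well.
    image-avoided : ∀ d → ¬ InImage (fun f d)
    image-avoided d (_ , x≈fd) = vertex-image-avoided (proj₁ (∂-fun-vmap f d))
      (tt , P-trans C x≈fd (P-sym C (proj₁ (∂-vertexPart C (P-sym C x≈fd)))))

    χ-avoiding : χ ∘ f ≈h const D outside
    χ-avoiding d
      rewrite ∈?-false (image-avoided d)
            | ∈?-false (vertex-image-avoided (proj₁ (∂-fun-vmap f d)))
            | ∈?-false (vertex-image-avoided (proj₂ (∂-fun-vmap f d))) = refl

  χ-at-point : fun χ (ι C x) ≡ inside
  χ-at-point rewrite ∈?-true {ι C x} (tt , P-refl C) = refl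

  coproduct-covers-vertices : ∀ {A B} (i₁ : Hom A C) (i₂ : Hom B C) → IsCoproduct i₁ i₂ →
                              Hits i₁ x ⊎ Hits i₂ x
  coproduct-covers-vertices i₁ i₂ isCop with em {Hits i₁ x} | em {Hits i₂ x}
  ... | yes hit | _ = inj₁ hit
  ... | no _ | yes hit = inj₂ hit
  ... | no ¬hit₁ | no ¬hit₂
    with ≡.trans {j = fun χ (ι C x)} (≡.sym χ-at-point)
           (coproduct-ext i₁ i₂ isCop χ (const C outside) (χ-avoiding i₁ ¬hit₁) (χ-avoiding i₂ ¬hit₂) (ι C x))
  ... | ()

module _ (em : ExcludedMiddle 0ℓ) {T C : Graph} (i₁ i₂ : Hom T C)
         (T-terminal : IsTerminal T) (isCop : IsCoproduct i₁ i₂) where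
  hits-≈ : ∀ (i : Hom T C) {y y'} → Hits i y → Hits i y' → _≈P_ C (ι C y) (ι C y')
  hits-≈ i (t , y≈it) (t' , y'≈it') =
    P-trans C (ι-cong C y≈it) (P-trans C (ι-vmap i t)
      (P-trans C (cong i (terminal-parts-≈ T-terminal (ι T t) (ι T t')))
        (P-trans C (P-sym C (ι-vmap i t')) (P-sym C (ι-cong C y'≈it')))))

  side : Hom C 𝟚ᴳ
  side = proj₁ (isCop 𝟚ᴳ (const T true) (const T false))

  side-hits : ∀ (i : Hom T C) b → side ∘ i ≈h const T b → ∀ {y} → Hits i y → fun side (ι C y) ≡ b
  side-hits i b side∘i≡b (t , y≈it) =
    ≡.trans (cong side (P-trans C (ι-cong C y≈it) (ι-vmap i t))) (side∘i≡b (ι T t))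

  sides-differ : ∀ {y y'} → Hits i₁ y → Hits i₂ y' → ¬ fun side (ι C y) ≡ fun side (ι C y')
  sides-differ hit₁ hit₂ same = true≢false (≡.trans (≡.sym (side-hits i₁ true side∘i₁ hit₁))
                                             (≡.trans same (side-hits i₂ false side∘i₂ hit₂)))
    where
    side∘i₁ = proj₁ (proj₂ (isCop 𝟚ᴳ (const T true) (const T false)))
    side∘i₂ = proj₁ (proj₂ (proj₂ (isCop 𝟚ᴳ (const T true) (const T false))))

  module _ (k : Hom Edge C) where
    ends-≈-via-vertices : _≈P_ C (ι C (vmap k src)) (ι C (vmap k tgt)) → _≈P_ C (fun k src) (fun k tgt)
    ends-≈-via-vertices e = P-trans C (P-sym C (ι-vmap k src)) (P-trans C e (ι-vmap k tgt))

    side-of-ends : fun side (ι C (vmap k src)) ≡ fun side (ι C (vmap k tgt))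
    side-of-ends = ≡.trans (cong side (ι-vmap k src))
                     (≡.trans (Edge→𝟚ᴳ-constant (side ∘ k)) (≡.sym (cong side (ι-vmap k tgt))))

  Edge→𝟙+𝟙-identifies-ends : ∀ (k : Hom Edge C) → _≈P_ C (fun k src) (fun k tgt)
  Edge→𝟙+𝟙-identifies-ends k with coproduct-covers-vertices em (vmap k src) i₁ i₂ isCop
                                  | coproduct-covers-vertices em (vmap k tgt) i₁ i₂ isCop
  ... | inj₁ s | inj₁ t = ends-≈-via-vertices k (hits-≈ i₁ s t)
  ... | inj₂ s | inj₂ t = ends-≈-via-vertices k (hits-≈ i₂ s t)
  ... | inj₁ s | inj₂ t = ⊥-elim (sides-differ s t (side-of-ends k))
  ... | inj₂ s | inj₁ t = ⊥-elim (sides-differ t s (≡.sym (side-of-ends k)))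

classifier-separates-Edge-ends : (soc : SubobjectClassifier) → let open SubobjectClassifier soc in
                                 Σ[ χ ∈ Hom Edge Ω ] ¬ _≈P_ Ω (fun χ src) (fun χ tgt)
classifier-separates-Edge-ends soc = χ , χsrc≉χtgt
  where
  open SubobjectClassifier soc
  classified = classify 𝟙ᴳ Edge atSrc (point-mono atSrc)
  χ = proj₁ classified
  pullback = proj₁ (proj₂ classified)
  -- Otherwise tgt would factor through the subobject {src}.
  χsrc≉χtgt : ¬ _≈P_ Ω (fun χ src) (fun χ tgt)
  χsrc≉χtgt χsrc≈χtgt with proj₂ pullback 𝟙ᴳ atTgt (proj₁ (𝟙-terminal 𝟙ᴳ))
                              (λ _ → P-trans Ω (P-sym Ω χsrc≈χtgt) (proj₁ pullback tt))
  ... | _ , atSrc∘u≈atTgt , _ with atSrc∘u≈atTgt tt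
  ... | ()

not-two-valued : ExcludedMiddle 0ℓ → ¬ L6
not-two-valued em (soc , C , i₁ , i₂ , isCop , Ω≅C) =
  χsrc≉χtgt (P-trans Ω (P-sym Ω (left (fun χ src)))
              (P-trans Ω (cong from to∘χ-identifies) (left (fun χ tgt))))
  where
  open SubobjectClassifier soc
  open Iso Ω≅C
  χ = proj₁ (classifier-separates-Edge-ends soc)
  χsrc≉χtgt = proj₂ (classifier-separates-Edge-ends soc)
  to∘χ-identifies = Edge→𝟙+𝟙-identifies-ends em i₁ i₂ 𝟙-terminal isCop (to ∘ χ)

-- Failure of exponentiation

_⊠_ : ∀ {X X'} → Hom X' X → (A : Graph) → Hom (X' ×ᴳ A) (X ×ᴳ A)
r ⊠ A = ProductGraph.⟨_,_⟩ _ A (r ∘ ProductGraph.π₁ _ A) (ProductGraph.π₂ _ A)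

module Exponential (l2 : L2) (A B : Graph) where
  prod : ∀ X Y → Product X Y
  prod = proj₁ (proj₂ l2)

  E : Graph
  E = proj₁ (proj₂ (proj₂ l2) A B)

  infix 5 _×ₚA
  _×ₚA : Graph → Graph
  X ×ₚA = Product.obj (prod X A)

  module _ {X : Graph} where
    open Product (prod X A) public using () renaming (π₁ to π₁ₚ; π₂ to π₂ₚ)

  ⟨_,_⟩ₚ : ∀ {X Y} → Hom Y X → Hom Y A → Hom Y (X ×ₚA)
  ⟨_,_⟩ₚ {X} = Product.⟨_,_⟩ (prod X A)

  β₁ : ∀ {X Y} (f : Hom Y X) (g : Hom Y A) → π₁ₚ ∘ ⟨ f , g ⟩ₚ ≈h f
  β₁ {X} {Y} f g = proj₁ (proj₂ (Product.isProduct (prod X A) Y f g))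

  β₂ : ∀ {X Y} (f : Hom Y X) (g : Hom Y A) → π₂ₚ ∘ ⟨ f , g ⟩ₚ ≈h g
  β₂ {X} {Y} f g = proj₁ (proj₂ (proj₂ (Product.isProduct (prod X A) Y f g)))

  ev : Hom (E ×ₚA) B
  ev = proj₁ (proj₂ (proj₂ (proj₂ l2) A B))

  _⊗ₚ : ∀ {X} → Hom X E → Hom (X ×ₚA) (E ×ₚA)
  k ⊗ₚ = ⟨ k ∘ π₁ₚ , π₂ₚ ⟩ₚ

  curry-universal : ∀ X (g : Hom (X ×ₚA) B) →
    Σ[ ḡ ∈ Hom X E ] ((ev ∘ ḡ ⊗ₚ ≈h g) × (∀ (ḡ' : Hom X E) → ev ∘ ḡ' ⊗ₚ ≈h g → ḡ' ≈h ḡ))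
  curry-universal = proj₂ (proj₂ (proj₂ (proj₂ l2) A B))

  module _ {X : Graph} where
    open ProductGraph X A public using () renaming (π₁ to π₁ᴳ; π₂ to π₂ᴳ)

  -- Transposition is taken against the concrete products ×ᴳ, on which maps can be evaluated;
  -- ψ and φ compare them with the chosen products.
  _⊗ᴳ : ∀ {X} → Hom X E → Hom (X ×ᴳ A) (E ×ₚA)
  k ⊗ᴳ = ⟨ k ∘ π₁ᴳ , π₂ᴳ ⟩ₚ

  uncurry : ∀ {X} → Hom X E → Hom (X ×ᴳ A) B
  uncurry k = ev ∘ k ⊗ᴳ

  ψ : ∀ X → Hom (X ×ₚA) (X ×ᴳ A)
  ψ X = ProductGraph.⟨_,_⟩ X A π₁ₚ π₂ₚ

  φ : ∀ X → Hom (X ×ᴳ A) (X ×ₚA)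
  φ X = ⟨ π₁ᴳ , π₂ᴳ ⟩ₚ

  ψ∘φ≈id : ∀ X → ψ X ∘ φ X ≈h idH (X ×ᴳ A)
  ψ∘φ≈id X = product-ext π₁ᴳ π₂ᴳ (ProductGraph.isProduct X A) (ψ X ∘ φ X) (idH (X ×ᴳ A))
               (β₁ (π₁ᴳ {X}) π₂ᴳ) (β₂ (π₁ᴳ {X}) π₂ᴳ)

  E×A-ext : ∀ {Y} (h h' : Hom Y (E ×ₚA)) → π₁ₚ ∘ h ≈h π₁ₚ ∘ h' → π₂ₚ ∘ h ≈h π₂ₚ ∘ h' → h ≈h h'
  E×A-ext = product-ext π₁ₚ π₂ₚ (Product.isProduct (prod E A))

  module _ {X : Graph} where
    ⊗ₚ-via-ψ : ∀ (k : Hom X E) → k ⊗ₚ ≈h k ⊗ᴳ ∘ ψ X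
    ⊗ₚ-via-ψ k = E×A-ext (k ⊗ₚ) (k ⊗ᴳ ∘ ψ X)
      (λ z → P-trans E (β₁ (k ∘ π₁ₚ) π₂ₚ z) (P-sym E (β₁ (k ∘ π₁ᴳ) π₂ᴳ (fun (ψ X) z))))
      (λ z → P-trans A (β₂ (k ∘ π₁ₚ) π₂ₚ z) (P-sym A (β₂ (k ∘ π₁ᴳ) π₂ᴳ (fun (ψ X) z))))

    ⊗ᴳ-via-φ : ∀ (k : Hom X E) → k ⊗ᴳ ≈h k ⊗ₚ ∘ φ X
    ⊗ᴳ-via-φ k = E×A-ext (k ⊗ᴳ) (k ⊗ₚ ∘ φ X)
      (λ z → P-trans E (β₁ (k ∘ π₁ᴳ) π₂ᴳ z)
               (P-trans E (cong k (P-sym X (β₁ (π₁ᴳ {X}) π₂ᴳ z))) (P-sym E (β₁ (k ∘ π₁ₚ) π₂ₚ (fun (φ X) z)))))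
      (λ z → P-trans A (β₂ (k ∘ π₁ᴳ) π₂ᴳ z)
               (P-trans A (P-sym A (β₂ (π₁ᴳ {X}) π₂ᴳ z)) (P-sym A (β₂ (k ∘ π₁ₚ) π₂ₚ (fun (φ X) z)))))

    ⊗ᴳ-cong : ∀ (k k' : Hom X E) → k ≈h k' → k ⊗ᴳ ≈h k' ⊗ᴳ
    ⊗ᴳ-cong k k' k≈k' = E×A-ext (k ⊗ᴳ) (k' ⊗ᴳ)
      (λ z → P-trans E (β₁ (k ∘ π₁ᴳ) π₂ᴳ z) (P-trans E (k≈k' _) (P-sym E (β₁ (k' ∘ π₁ᴳ) π₂ᴳ z))))
      (λ z → P-trans A (β₂ (k ∘ π₁ᴳ) π₂ᴳ z) (P-sym A (β₂ (k' ∘ π₁ᴳ) π₂ᴳ z)))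

    ⊗ᴳ-natural : ∀ {X'} (r : Hom X' X) (k : Hom X E) → (k ∘ r) ⊗ᴳ ≈h k ⊗ᴳ ∘ (r ⊠ A)
    ⊗ᴳ-natural r k = E×A-ext ((k ∘ r) ⊗ᴳ) (k ⊗ᴳ ∘ (r ⊠ A))
      (λ z → P-trans E (β₁ ((k ∘ r) ∘ π₁ᴳ) π₂ᴳ z) (P-sym E (β₁ (k ∘ π₁ᴳ) π₂ᴳ (fun (r ⊠ A) z))))
      (λ z → P-trans A (β₂ ((k ∘ r) ∘ π₁ᴳ) π₂ᴳ z) (P-sym A (β₂ (k ∘ π₁ᴳ) π₂ᴳ (fun (r ⊠ A) z))))

    uncurry-cong : ∀ (k k' : Hom X E) → k ≈h k' → uncurry k ≈h uncurry k'
    uncurry-cong k k' k≈k' z = cong ev (⊗ᴳ-cong k k' k≈k' z)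

    uncurry-natural : ∀ {X'} (r : Hom X' X) (k : Hom X E) → uncurry (k ∘ r) ≈h uncurry k ∘ (r ⊠ A)
    uncurry-natural r k z = cong ev (⊗ᴳ-natural r k z)

    uncurry-injective : ∀ (k k' : Hom X E) → uncurry k ≈h uncurry k' → k ≈h k'
    uncurry-injective k k' uk≈uk' x =
      P-trans E (unique k (λ _ → P-refl B) x) (P-sym E (unique k' ev∘k'≈ev∘k x))
      where
      unique = proj₂ (proj₂ (curry-universal X (ev ∘ k ⊗ₚ)))
      ev∘k'≈ev∘k : ev ∘ k' ⊗ₚ ≈h ev ∘ k ⊗ₚ
      ev∘k'≈ev∘k z = P-trans B (cong ev (⊗ₚ-via-ψ k' z))
                       (P-trans B (P-sym B (uk≈uk' (fun (ψ X) z))) (P-sym B (cong ev (⊗ₚ-via-ψ k z))))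

    curry : Hom (X ×ᴳ A) B → Hom X E
    curry h = proj₁ (curry-universal X (h ∘ ψ X))

    uncurry-curry : ∀ (h : Hom (X ×ᴳ A) B) → uncurry (curry h) ≈h h
    uncurry-curry h z = P-trans B (cong ev (⊗ᴳ-via-φ (curry h) z))
                          (P-trans B (proj₁ (proj₂ (curry-universal X (h ∘ ψ X))) (fun (φ X) z))
                            (cong h (ψ∘φ≈id X z)))

data DigonPart : Set where
  end : EdgeVertex → DigonPart
  edge₁ edge₂ : DigonPart

Digon : Graph
Digon = mkGraph DigonPart EdgeVertex end (λ { refl → refl }) ∂D (λ _ → refl)
  where
  ∂D : DigonPart → EdgeVertex × EdgeVertex
  ∂D (end v) = v , v
  ∂D edge₁ = src , tgt
  ∂D edge₂ = src , tgt

module _ where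
  open ProductGraph Edge Edge using (ends; _≈Vx_)

  diagonal-flag : ∀ {b b'} → UEq _≈Vx_ (ends (edge , edge , b)) (ends (edge , edge , b')) → b ≡ b'
  diagonal-flag {true} {true} _ = refl
  diagonal-flag {false} {false} _ = refl
  diagonal-flag {true} {false} (inj₁ ((_ , ()) , _))
  diagonal-flag {true} {false} (inj₂ ((() , _) , _))
  diagonal-flag {false} {true} (inj₁ ((_ , ()) , _))
  diagonal-flag {false} {true} (inj₂ ((() , _) , _))

  along : EdgePart → DigonPart
  along src = end src
  along tgt = end tgt
  along edge = edge₁

  split : P (Edge ×ᴳ Edge) → DigonPart
  split (edge , edge , true) = edge₁
  split (edge , edge , false) = edge₂
  split (_ , y , _) = along y

  split-cong : ∀ {x y} → _≈P_ (Edge ×ᴳ Edge) x y → split x ≡ split y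
  split-cong {x , y , b} {.x , .y , b'} (refl , refl , ends≈) = flag-irrelevant x y ends≈
    where
    flag-irrelevant : ∀ x y → UEq _≈Vx_ (ends (x , y , b)) (ends (x , y , b')) →
                      split (x , y , b) ≡ split (x , y , b')
    flag-irrelevant src _ _ = refl
    flag-irrelevant tgt _ _ = refl
    flag-irrelevant edge src _ = refl
    flag-irrelevant edge tgt _ = refl
    flag-irrelevant edge edge ends≈ = ≡.cong (λ b → split (edge , edge , b)) (diagonal-flag {b} {b'} ends≈)

  splitDiagonals : Hom (Edge ×ᴳ Edge) Digon
  splitDiagonals = record { fun = split ; cong = split-cong ; vertex = vx ; incident = inc }
    where
    vx : ∀ v → Σ[ w ∈ EdgeVertex ] end w ≡ split (ι (Edge ×ᴳ Edge) v)
    vx (src , b) = b , vx-along b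
      where
      vx-along : ∀ b → end b ≡ along (ι Edge b)
      vx-along src = refl
      vx-along tgt = refl
    vx (tgt , src) = src , refl
    vx (tgt , tgt) = tgt , refl
    inc : ∀ z → UEq _≡_ (ι Digon (∂₁ Digon (split z)) , ι Digon (∂₂ Digon (split z)))
                       (split (ι (Edge ×ᴳ Edge) (∂₁ (Edge ×ᴳ Edge) z)) ,
                        split (ι (Edge ×ᴳ Edge) (∂₂ (Edge ×ᴳ Edge) z)))
    inc (src , src , true) = inj₁ (refl , refl)
    inc (src , src , false) = inj₁ (refl , refl)
    inc (src , tgt , true) = inj₁ (refl , refl)
    inc (src , tgt , false) = inj₁ (refl , refl)
    inc (src , edge , true) = inj₁ (refl , refl)
    inc (src , edge , false) = inj₂ (refl , refl)
    inc (tgt , src , true) = inj₁ (refl , refl)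
    inc (tgt , src , false) = inj₁ (refl , refl)
    inc (tgt , tgt , true) = inj₁ (refl , refl)
    inc (tgt , tgt , false) = inj₁ (refl , refl)
    inc (tgt , edge , true) = inj₁ (refl , refl)
    inc (tgt , edge , false) = inj₂ (refl , refl)
    inc (edge , src , true) = inj₁ (refl , refl)
    inc (edge , src , false) = inj₁ (refl , refl)
    inc (edge , tgt , true) = inj₁ (refl , refl)
    inc (edge , tgt , false) = inj₁ (refl , refl)
    inc (edge , edge , true) = inj₁ (refl , refl)
    inc (edge , edge , false) = inj₂ (refl , refl)

  splitDiagonals-coequalizes : splitDiagonals ∘ (atSrc ⊠ Edge) ≈h splitDiagonals ∘ (atTgt ⊠ Edge)
  splitDiagonals-coequalizes (_ , src , _) = refl
  splitDiagonals-coequalizes (_ , tgt , _) = refl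
  splitDiagonals-coequalizes (_ , edge , _) = refl

collapse-factor : ∀ {X} (k : Hom Edge X) → _≈P_ X (fun k src) (fun k tgt) →
                  Σ[ k' ∈ Hom Loop X ] k ≈h k' ∘ collapse
collapse-factor {X} k ksrc≈ktgt = k' , k≈k'∘collapse
  where
  f : LoopPart → P X
  f base = fun k src
  f loop = fun k edge
  k' : Hom Loop X
  k' = record { fun = f ; cong = λ { refl → P-refl X } ; vertex = λ _ → vertex k src ; incident = inc }
    where
    inc : ∀ p → UEq (_≈P_ X) (ι X (∂₁ X (f p)) , ι X (∂₂ X (f p))) (fun k src , fun k src)
    inc base = incident k src
    inc loop = UP-trans X (incident k edge) (inj₁ (P-refl X , P-sym X ksrc≈ktgt))
  k≈k'∘collapse : k ≈h k' ∘ collapse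
  k≈k'∘collapse src = P-refl X
  k≈k'∘collapse tgt = P-sym X ksrc≈ktgt
  k≈k'∘collapse edge = P-refl X

loop×edge-flag-irrelevant : ∀ b b' → _≈P_ (Loop ×ᴳ Edge) (loop , edge , b) (loop , edge , b')
loop×edge-flag-irrelevant true true = refl , refl , inj₁ ((refl , refl) , (refl , refl))
loop×edge-flag-irrelevant false false = refl , refl , inj₁ ((refl , refl) , (refl , refl))
loop×edge-flag-irrelevant true false = refl , refl , inj₂ ((refl , refl) , (refl , refl))
loop×edge-flag-irrelevant false true = refl , refl , inj₂ ((refl , refl) , (refl , refl))

module _ (l2 : L2) where
  open Exponential l2 Edge Digon

  -- splitDiagonals coequalizes atSrc ⊠ Edge and atTgt ⊠ Edge but cannot factor through
  -- collapse ⊠ Edge, which merges the two diagonals that splitDiagonals keeps apart.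
  splitDiagonals-not-uncurried : ∀ (k : Hom Edge E) → ¬ uncurry k ≈h splitDiagonals
  splitDiagonals-not-uncurried k uk≈split = edge₁≢edge₂ (begin
    edge₁                                                          ≡⟨ factored (edge , edge , true) ⟩
    fun (uncurry k') (fun (collapse ⊠ Edge) (edge , edge , true))  ≡⟨ cong (uncurry k') diagonals-merge ⟩
    fun (uncurry k') (fun (collapse ⊠ Edge) (edge , edge , false)) ≡⟨ ≡.sym (factored (edge , edge , false)) ⟩
    edge₂                                                          ∎)
    where
    open ≡.≡-Reasoning
    edge₁≢edge₂ : ¬ edge₁ ≡ edge₂
    edge₁≢edge₂ ()
    ksrc≈ktgt : _≈P_ E (fun k src) (fun k tgt)
    ksrc≈ktgt = uncurry-injective (k ∘ atSrc) (k ∘ atTgt) uncurry-agrees tt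
      where
      uncurry-agrees : uncurry (k ∘ atSrc) ≈h uncurry (k ∘ atTgt)
      uncurry-agrees z = begin
        fun (uncurry (k ∘ atSrc)) z               ≡⟨ uncurry-natural atSrc k z ⟩
        fun (uncurry k) (fun (atSrc ⊠ Edge) z)    ≡⟨ uk≈split (fun (atSrc ⊠ Edge) z) ⟩
        fun splitDiagonals (fun (atSrc ⊠ Edge) z) ≡⟨ splitDiagonals-coequalizes z ⟩
        fun splitDiagonals (fun (atTgt ⊠ Edge) z) ≡⟨ ≡.sym (uk≈split (fun (atTgt ⊠ Edge) z)) ⟩
        fun (uncurry k) (fun (atTgt ⊠ Edge) z)    ≡⟨ ≡.sym (uncurry-natural atTgt k z) ⟩
        fun (uncurry (k ∘ atTgt)) z               ∎
    k' : Hom Loop E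
    k' = proj₁ (collapse-factor k ksrc≈ktgt)
    k≈k'∘collapse : k ≈h k' ∘ collapse
    k≈k'∘collapse = proj₂ (collapse-factor k ksrc≈ktgt)
    factored : ∀ z → fun splitDiagonals z ≡ fun (uncurry k') (fun (collapse ⊠ Edge) z)
    factored z = begin
      fun splitDiagonals z                       ≡⟨ ≡.sym (uk≈split z) ⟩
      fun (uncurry k) z                          ≡⟨ uncurry-cong k (k' ∘ collapse) k≈k'∘collapse z ⟩
      fun (uncurry (k' ∘ collapse)) z            ≡⟨ uncurry-natural collapse k' z ⟩
      fun (uncurry k') (fun (collapse ⊠ Edge) z) ∎
    diagonals-merge : _≈P_ (Loop ×ᴳ Edge) (fun (collapse ⊠ Edge) (edge , edge , true))
                                          (fun (collapse ⊠ Edge) (edge , edge , false))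
    diagonals-merge = loop×edge-flag-irrelevant (proj₂ (proj₂ (fun (collapse ⊠ Edge) (edge , edge , true))))
                                                (proj₂ (proj₂ (fun (collapse ⊠ Edge) (edge , edge , false))))

no-exponentials : ¬ L2
no-exponentials l2 =
  -- Without {Edge} the unifier has to invert _×ᴳ_, which is very slow.
  splitDiagonals-not-uncurried l2 (curry {Edge} splitDiagonals) (uncurry-curry {Edge} splitDiagonals)
  where open Exponential l2 Edge Digon

proposition3p1 : ExcludedMiddle 0ℓ → L1 × L3 × L4 × ¬ L2 × ¬ L5 × ¬ L6
proposition3p1 em =
  finite-limits-colimits , subobject-classifier em , natural-number-object ,
  no-exponentials , no-choice , not-two-valued em
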